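{- Let $\mathcal{F}$ be a union-closed family of finite sets with $\emptyset\in\mathcal{F}$, let $U\subseteq\bigcup\mathcal{F}$, let $X$ be a set with $X\cap U=\emptyset$, and let $Y\subseteq U$. Then $Y\in E(X)$ if and only if both of the following hold: (i) for every $x\in Y$ there exists $V\in J(\mathcal{F})$ with $x\in V\subseteq X\cup Y$; (ii) for every $V\in J(\mathcal{F})$ with $V\setminus U\subseteq X$, and every $x\in V\setminus U$, there exists $V'\in J(\mathcal{F})$ with $x\in V'\subseteq X\cup Y$.
   Context: $J(\mathcal{F})$ is the set of union generators of $\mathcal{F}$: the nonempty $V\in\mathcal{F}$ not equal to the union of the members of $\mathcal{F}$ properly contained in $V$. $\pi_{\mathcal{F}}(Z)=\bigcup\{V\in\mathcal{F}:V\subseteq Z\}$. For $X$ with $X\cap U=\emptyset$, $E(X)$ is the set of $Y\subseteq U$ such that $\pi_{\mathcal{F}}(X\cup Y)\cap U=Y$ and $\pi_{\mathcal{F}}(X\cup Y)\supseteq\pi_{\mathcal{F}}(X\cup U)\setminus U$. -}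

module Defs where

open import Data.Nat using (ℕ)
open import Data.Product using (_×_)
open import Data.List using (List; filter)
open import Data.Fin.Subset using (Subset; _∪_; _∩_; _─_; _⊆_; ⋃; Nonempty; ⊥)
open import Data.Fin.Subset.Properties using (_⊆?_; _⊂?_)
open import Relation.Binary.PropositionalEquality using (_≡_; _≢_)
import Data.List.Membership.Propositional as LM

Family : ℕ → Set
Family n = List (Subset n)

-- membership of a set in a family (Subset n = Vec Bool n, so ≡ is set equality)
_∈F_ : ∀ {n} → Subset n → Family n → Set
V ∈F F = V LM.∈ F

UnionClosed : ∀ {n} → Family n → Set
UnionClosed F = ∀ {A B} → A ∈F F → B ∈F F → (A ∪ B) ∈F F

π : ∀ {n} → Family n → Subset n → Subset n
π F Z = ⋃ (filter (_⊆? Z) F)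

_∈J_ : ∀ {n} → Subset n → Family n → Set
V ∈J F = V ∈F F × Nonempty V × V ≢ ⋃ (filter (_⊂? V) F)

InE : ∀ {n} → Family n → Subset n → Subset n → Subset n → Set
InE F U X Y = ((π F (X ∪ Y) ∩ U) ≡ Y) × ((π F (X ∪ U) ─ U) ⊆ π F (X ∪ Y))

-- Every member of F is the union of the union generators it contains (descend along ⊊, which
-- is well founded on finite sets), so x ∈ π_F(Z) exactly when some union generator V has
-- x ∈ V ⊆ Z. Both conditions defining E(X) are statements about membership in π_F, and this
-- description turns them into (i) and (ii); the only other input is X ∩ U = ∅, which forces
-- π_F(X ∪ Y) ∩ U ⊆ Y.
module Submission where

open import Defs
open import Data.Nat using (ℕ)
open import Data.Product using (_×_; ∃-syntax; _,_; proj₁)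
open import Data.Product.Function.NonDependent.Propositional using (_×-⇔_)
open import Data.Sum using (inj₁; inj₂)
open import Data.Fin using (Fin)
open import Data.Fin.Subset using (Subset; _∈_; _∉_; _∪_; _∩_; _─_; _⊆_; _⊂_; ⋃; Empty; ⊥; inside)
open import Data.Fin.Subset.Properties
  using (_∈?_; ∉⊥; ⊆-antisym; x∈p∩q⁺; x∈p∩q⁻; x∈p∪q⁺; x∈p∪q⁻; x∈p∧x∉q⇒x∈p─q; p─q⊆p; _⊆?_; _⊂?_)
open import Data.Fin.Subset.Induction using (⊂-wellFounded)
open import Data.List using (List; []; _∷_; filter)
open import Data.List.Relation.Unary.Any using (here; there)
open import Data.List.Membership.Propositional using () renaming (_∈_ to _∈ₗ_)
open import Data.List.Membership.Propositional.Properties using (∈-filter⁻; ∈-filter⁺)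
open import Data.Vec as Vec using (_∷_)
open import Data.Vec.Properties using (≡-dec)
open import Data.Bool.Properties using () renaming (_≟_ to _≟ᵇ_)
open import Data.Empty using (⊥-elim)
open import Function.Bundles using (_⇔_; mk⇔; Equivalence)
open import Function.Properties.Equivalence using () renaming (trans to ⇔-trans)
open import Induction.WellFounded using (Acc; acc)
open import Relation.Nullary using (yes; no)
open import Relation.Binary.PropositionalEquality using (_≡_; refl; subst)

private
  variable
    n : ℕ
    x : Fin n
    p q r : Subset n

x∈p─q⁻ : ∀ (p q : Subset n) → x ∈ p ─ q → x ∈ p × x ∉ q
x∈p─q⁻ p q x∈p─q = p─q⊆p p q x∈p─q , x∉q p q x∈p─q
  where
  x∉q : ∀ {n} {x : Fin n} (p q : Subset n) → x ∈ p ─ q → x ∉ q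
  x∉q (_ ∷ p) (_ ∷ q) (Vec.there x∈p─q) (Vec.there x∈q) = x∉q p q x∈p─q x∈q
  x∉q (_ ∷ p) (inside ∷ q) () Vec.here

p─q⊆r⇔p⊆r∪q : (p ─ q ⊆ r) ⇔ (p ⊆ r ∪ q)
p─q⊆r⇔p⊆r∪q {p = p} {q} {r} = mk⇔ to from
  where
  to : p ─ q ⊆ r → p ⊆ r ∪ q
  to p─q⊆r {y} y∈p with y ∈? q
  ... | yes y∈q = x∈p∪q⁺ (inj₂ y∈q)
  ... | no  y∉q = x∈p∪q⁺ (inj₁ (p─q⊆r (x∈p∧x∉q⇒x∈p─q y∈p y∉q)))
  from : p ⊆ r ∪ q → p ─ q ⊆ r
  from p⊆r∪q y∈p─q with x∈p─q⁻ p q y∈p─q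
  ... | y∈p , y∉q with x∈p∪q⁻ r q (p⊆r∪q y∈p)
  ...   | inj₁ y∈r = y∈r
  ...   | inj₂ y∈q = ⊥-elim (y∉q y∈q)

p∩q≡r⇔r⊆p : p ∩ q ⊆ r → r ⊆ q → (p ∩ q ≡ r) ⇔ (r ⊆ p)
p∩q≡r⇔r⊆p {p = p} {q} p∩q⊆r r⊆q = mk⇔
  (λ { refl y∈p∩q → proj₁ (x∈p∩q⁻ p q y∈p∩q) })
  (λ r⊆p → ⊆-antisym p∩q⊆r (λ y∈r → x∈p∩q⁺ (r⊆p y∈r , r⊆q y∈r)))

x∈⋃⁻ : ∀ (Ws : List (Subset n)) → x ∈ ⋃ Ws → ∃[ W ] (W ∈ₗ Ws × x ∈ W)
x∈⋃⁻ []       x∈⋃ = ⊥-elim (∉⊥ x∈⋃)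
x∈⋃⁻ (W ∷ Ws) x∈⋃ with x∈p∪q⁻ W (⋃ Ws) x∈⋃
... | inj₁ x∈W = W , here refl , x∈W
... | inj₂ x∈⋃Ws with x∈⋃⁻ Ws x∈⋃Ws
...   | W′ , W′∈Ws , x∈W′ = W′ , there W′∈Ws , x∈W′

x∈⋃⁺ : ∀ {W} {Ws : List (Subset n)} → W ∈ₗ Ws → x ∈ W → x ∈ ⋃ Ws
x∈⋃⁺ (here refl)  x∈W = x∈p∪q⁺ (inj₁ x∈W)
x∈⋃⁺ (there W∈Ws) x∈W = x∈p∪q⁺ (inj₂ (x∈⋃⁺ W∈Ws x∈W))

J-covered : Family n → Subset n → Fin n → Set
J-covered F Z x = ∃[ V ] (V ∈J F × x ∈ V × V ⊆ Z)

J-covered-mono : ∀ {F : Family n} {Z Z′} → Z ⊆ Z′ → J-covered F Z x → J-covered F Z′ x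
J-covered-mono Z⊆Z′ (V , V∈J , x∈V , V⊆Z) = V , V∈J , x∈V , λ y∈V → Z⊆Z′ (V⊆Z y∈V)

∈F⇒J-covered : ∀ (F : Family n) {V} → V ∈F F → x ∈ V → J-covered F V x
∈F⇒J-covered F {V} = go V (⊂-wellFounded V)
  where
  go : ∀ {x} V → Acc _⊂_ V → V ∈F F → x ∈ V → J-covered F V x
  go V (acc below) V∈F x∈V with ≡-dec _≟ᵇ_ V (⋃ (filter (_⊂? V) F))
  ... | no  V≢⋃ = V , (V∈F , (_ , x∈V) , V≢⋃) , x∈V , λ y∈V → y∈V
  ... | yes V≡⋃ with x∈⋃⁻ (filter (_⊂? V) F) (subst (_ ∈_) V≡⋃ x∈V)
  ...   | W , W∈filter , x∈W with ∈-filter⁻ (_⊂? V) {xs = F} W∈filter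
  ...     | W∈F , W⊂V = J-covered-mono (proj₁ W⊂V) (go W (below W⊂V) W∈F x∈W)

∈π⇔J-covered : ∀ (F : Family n) Z → (x ∈ π F Z) ⇔ J-covered F Z x
∈π⇔J-covered F Z = mk⇔ to from
  where
  to : x ∈ π F Z → J-covered F Z x
  to x∈π with x∈⋃⁻ (filter (_⊆? Z) F) x∈π
  ... | W , W∈filter , x∈W with ∈-filter⁻ (_⊆? Z) {xs = F} W∈filter
  ...   | W∈F , W⊆Z = J-covered-mono W⊆Z (∈F⇒J-covered F W∈F x∈W)
  from : J-covered F Z x → x ∈ π F Z
  from (V , (V∈F , _) , x∈V , V⊆Z) = x∈⋃⁺ (∈-filter⁺ (_⊆? Z) V∈F V⊆Z) x∈V

π⊆ : ∀ (F : Family n) Z → π F Z ⊆ Z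
π⊆ F Z x∈π with Equivalence.to (∈π⇔J-covered F Z) x∈π
... | _ , _ , x∈V , V⊆Z = V⊆Z x∈V

⊆π⇔J-covered : ∀ (F : Family n) {Y} Z → (Y ⊆ π F Z) ⇔ (∀ {x} → x ∈ Y → J-covered F Z x)
⊆π⇔J-covered F Z = mk⇔
  (λ Y⊆π {_} y∈Y → Equivalence.to (∈π⇔J-covered F Z) (Y⊆π y∈Y))
  (λ covered {_} y∈Y → Equivalence.from (∈π⇔J-covered F Z) (covered y∈Y))

π∩U≡Y⇔J-covered : ∀ (F : Family n) {U X Y} → Empty (X ∩ U) → Y ⊆ U →
  (π F (X ∪ Y) ∩ U ≡ Y) ⇔ (∀ {x} → x ∈ Y → J-covered F (X ∪ Y) x)
π∩U≡Y⇔J-covered F {U} {X} {Y} X∩U=∅ Y⊆U =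
  ⇔-trans (p∩q≡r⇔r⊆p π∩U⊆Y Y⊆U) (⊆π⇔J-covered F (X ∪ Y))
  where
  π∩U⊆Y : π F (X ∪ Y) ∩ U ⊆ Y
  π∩U⊆Y y∈π∩U with x∈p∩q⁻ (π F (X ∪ Y)) U y∈π∩U
  ... | y∈π , y∈U with x∈p∪q⁻ X Y (π⊆ F (X ∪ Y) y∈π)
  ...   | inj₁ y∈X = ⊥-elim (X∩U=∅ (_ , x∈p∩q⁺ (y∈X , y∈U)))
  ...   | inj₂ y∈Y = y∈Y

π─U⊆π⇔J-covered : ∀ (F : Family n) {U X} Z →
  (π F (X ∪ U) ─ U ⊆ π F Z) ⇔
  (∀ {V} → V ∈J F → V ─ U ⊆ X → ∀ {x} → x ∈ V ─ U → J-covered F Z x)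
π─U⊆π⇔J-covered F {U} {X} Z = mk⇔ to from
  where
  to : π F (X ∪ U) ─ U ⊆ π F Z →
       ∀ {V} → V ∈J F → V ─ U ⊆ X → ∀ {x} → x ∈ V ─ U → J-covered F Z x
  to π─U⊆π {V} V∈J V─U⊆X x∈V─U with x∈p─q⁻ V U x∈V─U
  ... | x∈V , x∉U = Equivalence.to (∈π⇔J-covered F Z) (π─U⊆π (x∈p∧x∉q⇒x∈p─q x∈π x∉U))
    where
    x∈π : _ ∈ π F (X ∪ U)
    x∈π = Equivalence.from (∈π⇔J-covered F (X ∪ U))
            (V , V∈J , x∈V , Equivalence.to p─q⊆r⇔p⊆r∪q V─U⊆X)
  from : (∀ {V} → V ∈J F → V ─ U ⊆ X → ∀ {x} → x ∈ V ─ U → J-covered F Z x) →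
         π F (X ∪ U) ─ U ⊆ π F Z
  from covered x∈π─U with x∈p─q⁻ (π F (X ∪ U)) U x∈π─U
  ... | x∈π , x∉U with Equivalence.to (∈π⇔J-covered F (X ∪ U)) x∈π
  ...   | V , V∈J , x∈V , V⊆X∪U = Equivalence.from (∈π⇔J-covered F Z)
          (covered V∈J (Equivalence.from p─q⊆r⇔p⊆r∪q V⊆X∪U) (x∈p∧x∉q⇒x∈p─q x∈V x∉U))

lemma3p10 : ∀ {n} (F : Family n) → UnionClosed F → ⊥ ∈F F →
    (U X Y : Subset n) → U ⊆ ⋃ F → Empty (X ∩ U) → Y ⊆ U →
    InE F U X Y ⇔
      ((∀ {x} → x ∈ Y → ∃[ V ] (V ∈J F × x ∈ V × V ⊆ X ∪ Y))
      × (∀ {V} → V ∈J F → (V ─ U) ⊆ X → ∀ {x} → x ∈ (V ─ U) →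
           ∃[ V′ ] (V′ ∈J F × x ∈ V′ × V′ ⊆ X ∪ Y)))
lemma3p10 F _ _ U X Y _ X∩U=∅ Y⊆U =
  π∩U≡Y⇔J-covered F X∩U=∅ Y⊆U ×-⇔ π─U⊆π⇔J-covered F (X ∪ Y)
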